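{- Let $T=(N_1,\ldots,N_t)$ be a problem instance of CPTs for $V_n$ and $P\subseteq\{V_1,\ldots,V_{n-1}\}$, and let $N^a$ be the CPT output by Algorithm 2 on input $(T,P)$. Then $f_T(N^a)\le f_T(N)$ for every CPT $N$ for $V_n$ with $Pa(N,V_n)\subseteq P$.
   Context: Binary attributes $V_1,\ldots,V_n$, each with domain $\{0,1\}$. For $Q\subseteq\{V_1,\ldots,V_{n-1}\}$, $\mathrm{Inst}(Q)$ is the set of assignments of values in $\{0,1\}$ to the attributes of $Q$ (contexts); two contexts are consistent if they agree on their common attributes. A (complete) CPT $N$ for $V_n$ consists of a parent set $Pa(N,V_n)\subseteq\{V_1,\ldots,V_{n-1}\}$ and, for each $\gamma\in\mathrm{Inst}(Pa(N,V_n))$, exactly one rule, either $\gamma:0\succ 1$ or $\gamma:1\succ 0$. A swap over $V_n$ is identified with an element $x\in\{0,1\}^{n-1}$; the vote of $N$ on $x$ is $0$ if the rule of $N$ whose context agrees with $x$ on $Pa(N,V_n)$ is of the form $\gamma:0\succ1$, and $1$ otherwise. $\Delta(N,N')$ is the number of swaps on which $N,N'$ vote differently, and for a tuple $T=(N_1,\ldots,N_t)$ of CPTs for $V_n$, $f_T(N)=\sum_{s=1}^t\Delta(N,N_s)$. Algorithm 2, on input $(T,P)$: for each $\gamma\in\mathrm{Inst}(P)$ it computes $\mathit{zerovotes}(\gamma)=\sum_{s=1}^t r_s(\gamma)\cdot 2^{\,n-|Pa(N_s,V_n)|-1}/2^{\,|P\setminus Pa(N_s,V_n)|}$, where $r_s(\gamma)$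 is the number of rules of $N_s$ of the form $\delta:0\succ1$ with $\delta$ consistent with $\gamma$ (this equals the number of pairs $(x,s)$ with $x$ a swap agreeing with $\gamma$ on $P$ and $N_s$ voting $0$ on $x$), and $\mathit{onevotes}(\gamma)=t\cdot2^{\,n-|P|-1}-\mathit{zerovotes}(\gamma)$; it puts the rule $\gamma:0\succ1$ into the output CPT (parent set $P$) if $\mathit{zerovotes}(\gamma)>\mathit{onevotes}(\gamma)$ and $\gamma:1\succ0$ otherwise. Finally it removes irrelevant parents, i.e., attributes of $P$ on whose value the rule's preference never depends; this yields a CPT with a smaller parent set that casts the same vote on every swap. -}

module Defs where

open import Data.Bool using (Bool; true; false; if_then_else_; _∧_; _∨_; not; _xor_; T)
open import Data.Nat using (ℕ; zero; suc; _+_; _*_; _∸_; _^_; _<ᵇ_)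
open import Data.Nat.Properties using (m^n≢0)
open import Data.Nat.DivMod using (_/_)
open import Data.Product using (_×_; _,_)
open import Data.Unit using (⊤; tt)
open import Data.Fin using (Fin)
open import Data.Fin.Subset using (Subset; _─_; ∣_∣; ⁅_⁆)
open import Data.Vec using (Vec; []; _∷_; tabulate; lookup; updateAt; map)
open import Data.List using (List; []; _∷_; _++_; concatMap; length) renaming (map to lmap)
open import Data.Nat.ListAction using () renaming (sum to lsum)
open import Data.Bool.ListAction using (any)

-- Attributes V_1,…,V_{n-1} are indexed by Fin m, where m = n - 1.
-- Value 0 is encoded as false, value 1 as true.
-- A subset Q ⊆ {V_1,…,V_{n-1}} is a Subset m (Vec Bool m, true = member).

InstStep : {m : ℕ} → Bool → Set → Set
InstStep true  X = Bool × X
InstStep false X = X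

Inst : {m : ℕ} → Subset m → Set
Inst []      = ⊤
Inst {suc m} (b ∷ Q) = InstStep {m} b (Inst Q)

allInst : {m : ℕ} → (Q : Subset m) → List (Inst Q)
allInst []            = tt ∷ []
allInst (true  ∷ Q) = concatMap (λ v → lmap (λ γ → (v , γ)) (allInst Q)) (true ∷ false ∷ [])
allInst (false ∷ Q) = allInst Q

-- a swap over V_n is an element of {0,1}^{n-1}
Swap : ℕ → Set
Swap m = Vec Bool m

allSwaps : (m : ℕ) → List (Swap m)
allSwaps zero    = [] ∷ []
allSwaps (suc m) = concatMap (λ v → lmap (v ∷_) (allSwaps m)) (true ∷ false ∷ [])

restrict : {m : ℕ} → (Q : Subset m) → Swap m → Inst Q
restrict []          []      = tt
restrict (true  ∷ Q) (v ∷ x) = v , restrict Q x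
restrict (false ∷ Q) (v ∷ x) = restrict Q x

embed : {m : ℕ} → (Q : Subset m) → Inst Q → Swap m
embed []          tt      = []
embed (true  ∷ Q) (v , γ) = v ∷ embed Q γ
embed (false ∷ Q) γ       = false ∷ embed Q γ

_==_ : Bool → Bool → Bool
a == b = not (a xor b)

consistent : {m : ℕ} → (A B : Subset m) → Inst A → Inst B → Bool
consistent []          []          tt       tt       = true
consistent (true  ∷ A) (true  ∷ B) (u , δ) (v , γ) = (u == v) ∧ consistent A B δ γ
consistent (true  ∷ A) (false ∷ B) (u , δ) γ        = consistent A B δ γ
consistent (false ∷ A) (true  ∷ B) δ        (v , γ) = consistent A B δ γ
consistent (false ∷ A) (false ∷ B) δ        γ        = consistent A B δ γ

-- A complete CPT for V_n: a parent set and exactly one rule per context.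
-- rule γ = false  means  γ : 0 ≻ 1 ;  rule γ = true  means  γ : 1 ≻ 0.
record CPT (m : ℕ) : Set where
  constructor mkCPT
  field
    Pa   : Subset m
    rule : Inst Pa → Bool
open CPT public

vote : {m : ℕ} → CPT m → Swap m → Bool
vote N x = rule N (restrict (Pa N) x)

count : {A : Set} → (A → Bool) → List A → ℕ
count p []       = 0
count p (a ∷ as) = (if p a then 1 else 0) + count p as

Δ : {m : ℕ} → CPT m → CPT m → ℕ
Δ {m} N N′ = count (λ x → vote N x xor vote N′ x) (allSwaps m)

f : {m : ℕ} → List (CPT m) → CPT m → ℕ
f T N = lsum (lmap (Δ N) T)

r : {m : ℕ} → (P : Subset m) → CPT m → Inst P → ℕ
r P Ns γ = count (λ δ → not (rule Ns δ) ∧ consistent (Pa Ns) P δ γ) (allInst (Pa Ns))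

_/2^_ : ℕ → ℕ → ℕ
a /2^ k = _/_ a (2 ^ k) {{m^n≢0 2 k}}

zerovotes : {m : ℕ} → List (CPT m) → (P : Subset m) → Inst P → ℕ
zerovotes {m} T P γ =
  lsum (lmap (λ Ns → (r P Ns γ * 2 ^ (m ∸ ∣ Pa Ns ∣)) /2^ ∣ P ─ Pa Ns ∣) T)

onevotes : {m : ℕ} → List (CPT m) → (P : Subset m) → Inst P → ℕ
onevotes {m} T P γ = length T * 2 ^ (m ∸ ∣ P ∣) ∸ zerovotes T P γ

alg2-raw : {m : ℕ} → List (CPT m) → Subset m → CPT m
alg2-raw T P = mkCPT P (λ γ → not (onevotes T P γ <ᵇ zerovotes T P γ))

relevant : {m : ℕ} → CPT m → Fin m → Bool
relevant {m} N i =
  lookup (Pa N) i ∧ any (λ x → vote N x xor vote N (updateAt x i not)) (allSwaps m)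

removeIrrelevant : {m : ℕ} → CPT m → CPT m
removeIrrelevant {m} N = mkCPT R (λ δ → vote N (embed R δ))
  where
    R : Subset m
    R = tabulate (relevant N)

alg2 : {m : ℕ} → List (CPT m) → Subset m → CPT m
alg2 T P = removeIrrelevant (alg2-raw T P)

module Submission where

open import Defs
open import Data.Nat using (ℕ; _≤_)
open import Data.List using (List)
open import Data.Fin.Subset using (Subset; _⊆_)

open import Data.Bool using (Bool; true; false; if_then_else_; _∧_; not; _xor_; T)
open import Data.Bool.ListAction using (any)
open import Data.Bool.Properties using (∧-zeroʳ)
open import Data.Fin using (Fin) renaming (zero to fzero; suc to fsuc)
open import Data.Fin.Subset using (_─_; ∣_∣)
open import Data.Fin.Subset.Properties using (∣p∣≤n; drop-∷-⊆)
open import Data.List using ([]; _∷_; _++_; concatMap; length) renaming (map to lmap)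
open import Data.List.Properties using (++-identityʳ)
open import Data.Nat using (zero; suc; _+_; _*_; _∸_; _^_; _<ᵇ_)
open import Data.Nat.DivMod using (m*n/n≡m)
open import Data.Nat.ListAction using () renaming (sum to lsum)
open import Data.Nat.Properties
open import Algebra.Properties.CommutativeSemigroup +-commutativeSemigroup using (interchange)
open import Data.Nat.Tactic.RingSolver using (solve-∀)
open import Data.Product using (_,_)
open import Data.Unit using (tt)
open import Data.Vec using ([]; _∷_; here; lookup; tabulate; updateAt)
open import Data.Vec.Properties using (lookup∘tabulate)
open import Relation.Binary.PropositionalEquality

-- Every CPT N with Pa(N) ⊆ P votes like the CPT with parent set P whose rule
-- at γ is N's vote on any swap extending γ, and f_T depends on a CPT only
-- through its votes.  For a CPT with parent set P, f_T splits into a sum over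
-- the contexts γ ∈ Inst(P) of the disagreements on the swaps extending γ, and
-- each summand depends only on the rule at γ: choosing 1 costs the number of
-- pairs (x, s) with N_s voting 0, which is zerovotes(γ), and choosing 0 costs
-- onevotes(γ).  The scaling in zerovotes is exact because a rule δ of N_s
-- consistent with γ is shared by 2^(n-1-|Pa_s|) swaps, of which a fraction
-- 2^(-|P ∖ Pa_s|) extends γ.  Algorithm 2 thus picks the cheaper value at
-- every context, and removing irrelevant parents does not change any vote.

indicator : Bool → ℕ
indicator b = if b then 1 else 0

indicator≡0 : ∀ b → indicator b ≡ 0 → b ≡ false
indicator≡0 false _ = refl

xor≡false⇒≡ : ∀ a b → a xor b ≡ false → a ≡ b
xor≡false⇒≡ true  true  _ = refl
xor≡false⇒≡ false false _ = refl

count-++ : ∀ {A : Set} (p : A → Bool) xs ys → count p (xs ++ ys) ≡ count p xs + count p ys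
count-++ p []       ys = refl
count-++ p (x ∷ xs) ys = trans (cong (indicator (p x) +_) (count-++ p xs ys))
                               (sym (+-assoc (indicator (p x)) (count p xs) (count p ys)))

count-map : ∀ {A B : Set} (p : B → Bool) (g : A → B) xs → count p (lmap g xs) ≡ count (λ a → p (g a)) xs
count-map p g []       = refl
count-map p g (x ∷ xs) = cong (indicator (p (g x)) +_) (count-map p g xs)

count-concatMap-Bool : ∀ {A B : Set} (p : B → Bool) (g : Bool → A → B) xs →
  count p (concatMap (λ v → lmap (g v) xs) (true ∷ false ∷ [])) ≡
  count (λ a → p (g true a)) xs + count (λ a → p (g false a)) xs
count-concatMap-Bool p g xs = begin
  count p (lmap (g true) xs ++ lmap (g false) xs ++ [])
    ≡⟨ count-++ p (lmap (g true) xs) _ ⟩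
  count p (lmap (g true) xs) + count p (lmap (g false) xs ++ [])
    ≡⟨ cong₂ _+_ (count-map p (g true) xs) (cong (count p) (++-identityʳ (lmap (g false) xs))) ⟩
  count (λ a → p (g true a)) xs + count p (lmap (g false) xs)
    ≡⟨ cong (_ +_) (count-map p (g false) xs) ⟩
  count (λ a → p (g true a)) xs + count (λ a → p (g false a)) xs ∎
  where open ≡-Reasoning

count-∧-false : ∀ {A : Set} (p : A → Bool) xs → count (λ a → p a ∧ false) xs ≡ 0
count-∧-false p []       = refl
count-∧-false p (x ∷ xs) rewrite ∧-zeroʳ (p x) = count-∧-false p xs

any≡false⇒count≡0 : ∀ {A : Set} (p : A → Bool) xs → any p xs ≡ false → count p xs ≡ 0
any≡false⇒count≡0 p []       _ = refl
any≡false⇒count≡0 p (x ∷ xs) e with p x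
... | false = any≡false⇒count≡0 p xs e

*-double : ∀ c q → c * (2 * q) ≡ c * q + c * q
*-double = solve-∀

double-*2^-∸ : ∀ {m} (A : Subset m) {a} c → a ≡ c * 2 ^ (m ∸ ∣ A ∣) → a + a ≡ c * 2 ^ (suc m ∸ ∣ A ∣)
double-*2^-∸ {m} A c refl = begin
  c * 2 ^ (m ∸ ∣ A ∣) + c * 2 ^ (m ∸ ∣ A ∣) ≡⟨ sym (*-double c (2 ^ (m ∸ ∣ A ∣))) ⟩
  c * (2 * 2 ^ (m ∸ ∣ A ∣))                 ≡⟨ cong (λ e → c * 2 ^ e) (sym (+-∸-assoc 1 (∣p∣≤n A))) ⟩
  c * 2 ^ (suc m ∸ ∣ A ∣)                   ∎
  where open ≡-Reasoning

sumSwaps : (m : ℕ) → (Swap m → ℕ) → ℕ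
sumSwaps zero   h = h []
sumSwaps (suc m) h = sumSwaps m (λ x → h (true ∷ x)) + sumSwaps m (λ x → h (false ∷ x))

sumSwaps-cong : ∀ m {g h : Swap m → ℕ} → (∀ x → g x ≡ h x) → sumSwaps m g ≡ sumSwaps m h
sumSwaps-cong zero    e = e []
sumSwaps-cong (suc m) e = cong₂ _+_ (sumSwaps-cong m (λ x → e (true ∷ x)))
                                    (sumSwaps-cong m (λ x → e (false ∷ x)))

sumSwaps-+ : ∀ m (g h : Swap m → ℕ) → sumSwaps m (λ x → g x + h x) ≡ sumSwaps m g + sumSwaps m h
sumSwaps-+ zero    g h = refl
sumSwaps-+ (suc m) g h = begin
  sumSwaps m (λ x → g (true ∷ x) + h (true ∷ x)) + sumSwaps m (λ x → g (false ∷ x) + h (false ∷ x))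
    ≡⟨ cong₂ _+_ (sumSwaps-+ m _ _) (sumSwaps-+ m _ _) ⟩
  (sumSwaps m (λ x → g (true ∷ x)) + sumSwaps m (λ x → h (true ∷ x))) +
  (sumSwaps m (λ x → g (false ∷ x)) + sumSwaps m (λ x → h (false ∷ x)))
    ≡⟨ interchange (sumSwaps m (λ x → g (true ∷ x))) (sumSwaps m (λ x → h (true ∷ x)))
                   (sumSwaps m (λ x → g (false ∷ x))) (sumSwaps m (λ x → h (false ∷ x))) ⟩
  sumSwaps (suc m) g + sumSwaps (suc m) h ∎
  where open ≡-Reasoning

sumSwaps≡0⇒≡0 : ∀ m (h : Swap m → ℕ) → sumSwaps m h ≡ 0 → ∀ z → h z ≡ 0
sumSwaps≡0⇒≡0 zero    h e []          = e
sumSwaps≡0⇒≡0 (suc m) h e (true ∷ z)  = sumSwaps≡0⇒≡0 m _ (m+n≡0⇒m≡0 _ e) z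
sumSwaps≡0⇒≡0 (suc m) h e (false ∷ z) = sumSwaps≡0⇒≡0 m _ (m+n≡0⇒n≡0 _ e) z

count-allSwaps : ∀ m (p : Swap m → Bool) → count p (allSwaps m) ≡ sumSwaps m (λ x → indicator (p x))
count-allSwaps zero    p = +-identityʳ _
count-allSwaps (suc m) p = trans (count-concatMap-Bool p _∷_ (allSwaps m))
  (cong₂ _+_ (count-allSwaps m (λ x → p (true ∷ x))) (count-allSwaps m (λ x → p (false ∷ x))))

any-allSwaps≡false : ∀ m (p : Swap m → Bool) → any p (allSwaps m) ≡ false → ∀ z → p z ≡ false
any-allSwaps≡false m p e z = indicator≡0 (p z)
  (sumSwaps≡0⇒≡0 m _ (trans (sym (count-allSwaps m p)) (any≡false⇒count≡0 p (allSwaps m) e)) z)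

sumExtending : ∀ {m} (P : Subset m) → Inst P → (Swap m → ℕ) → ℕ
sumExtending []          tt      h = h []
sumExtending (true  ∷ P) (v , γ) h = sumExtending P γ (λ x → h (v ∷ x))
sumExtending (false ∷ P) γ       h =
  sumExtending P γ (λ x → h (true ∷ x)) + sumExtending P γ (λ x → h (false ∷ x))

sumExtending-cong : ∀ {m} (P : Subset m) γ {g h : Swap m → ℕ} → (∀ x → g x ≡ h x) →
  sumExtending P γ g ≡ sumExtending P γ h
sumExtending-cong []          tt      e = e []
sumExtending-cong (true  ∷ P) (v , γ) e = sumExtending-cong P γ (λ x → e (v ∷ x))
sumExtending-cong (false ∷ P) γ       e = cong₂ _+_ (sumExtending-cong P γ (λ x → e (true ∷ x)))
                                                    (sumExtending-cong P γ (λ x → e (false ∷ x)))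

sumExtending-+ : ∀ {m} (P : Subset m) γ (g h : Swap m → ℕ) →
  sumExtending P γ (λ x → g x + h x) ≡ sumExtending P γ g + sumExtending P γ h
sumExtending-+ []          tt      g h = refl
sumExtending-+ (true  ∷ P) (v , γ) g h = sumExtending-+ P γ _ _
sumExtending-+ (false ∷ P) γ       g h =
  trans (cong₂ _+_ (sumExtending-+ P γ (λ x → g (true ∷ x)) (λ x → h (true ∷ x)))
                   (sumExtending-+ P γ (λ x → g (false ∷ x)) (λ x → h (false ∷ x))))
        (interchange (sumExtending P γ (λ x → g (true ∷ x))) (sumExtending P γ (λ x → h (true ∷ x)))
                     (sumExtending P γ (λ x → g (false ∷ x))) (sumExtending P γ (λ x → h (false ∷ x))))

sumExtending-const : ∀ {m} (P : Subset m) γ c → sumExtending P γ (λ _ → c) ≡ c * 2 ^ (m ∸ ∣ P ∣)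
sumExtending-const []          tt      c = sym (*-identityʳ c)
sumExtending-const (true  ∷ P) (v , γ) c = sumExtending-const P γ c
sumExtending-const (false ∷ P) γ       c = double-*2^-∸ P c (sumExtending-const P γ c)

contextwise-optimal : ∀ m (P : Subset m) (W : Bool → Swap m → ℕ) (A C : Inst P → Bool) →
  (∀ γ b → sumExtending P γ (W (A γ)) ≤ sumExtending P γ (W b)) →
  sumSwaps m (λ x → W (A (restrict P x)) x) ≤ sumSwaps m (λ x → W (C (restrict P x)) x)
contextwise-optimal zero    []          W A C opt = opt tt (C tt)
contextwise-optimal (suc m) (true ∷ P)  W A C opt = +-mono-≤
  (contextwise-optimal m P (λ b x → W b (true ∷ x)) (λ γ → A (true , γ)) (λ γ → C (true , γ))
     (λ γ → opt (true , γ)))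
  (contextwise-optimal m P (λ b x → W b (false ∷ x)) (λ γ → A (false , γ)) (λ γ → C (false , γ))
     (λ γ → opt (false , γ)))
contextwise-optimal (suc m) (false ∷ P) W A C opt = subst₂ _≤_ (sumSwaps-+ m _ _) (sumSwaps-+ m _ _)
  (contextwise-optimal m P (λ b x → W b (true ∷ x) + W b (false ∷ x)) A C
     (λ γ b → subst₂ _≤_ (sym (sumExtending-+ P γ _ _)) (sym (sumExtending-+ P γ _ _)) (opt γ b)))

matchingSwaps : ∀ {m} (A B : Subset m) → (Inst A → Bool) → Inst B → ℕ
matchingSwaps A B ρ γ = sumExtending B γ (λ x → indicator (ρ (restrict A x)))

consistentRules : ∀ {m} (A B : Subset m) → (Inst A → Bool) → Inst B → ℕ
consistentRules A B ρ γ = count (λ δ → ρ δ ∧ consistent A B δ γ) (allInst A)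

consistentRules-true-true : ∀ {m} (A B : Subset m) ρ v γ →
  consistentRules (true ∷ A) (true ∷ B) ρ (v , γ) ≡ consistentRules A B (λ δ → ρ (v , δ)) γ
consistentRules-true-true A B ρ true γ =
  trans (count-concatMap-Bool _ _,_ (allInst A))
        (trans (cong (consistentRules A B (λ δ → ρ (true , δ)) γ +_)
                     (count-∧-false (λ δ → ρ (false , δ)) (allInst A)))
               (+-identityʳ _))
consistentRules-true-true A B ρ false γ =
  trans (count-concatMap-Bool _ _,_ (allInst A))
        (cong (_+ consistentRules A B (λ δ → ρ (false , δ)) γ)
              (count-∧-false (λ δ → ρ (true , δ)) (allInst A)))

consistentRules-true-false : ∀ {m} (A B : Subset m) ρ γ →
  consistentRules (true ∷ A) (false ∷ B) ρ γ ≡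
  consistentRules A B (λ δ → ρ (true , δ)) γ + consistentRules A B (λ δ → ρ (false , δ)) γ
consistentRules-true-false A B ρ γ = count-concatMap-Bool _ _,_ (allInst A)

matchingSwaps-scaled : ∀ {m} (A B : Subset m) ρ γ →
  matchingSwaps A B ρ γ * 2 ^ ∣ B ─ A ∣ ≡ consistentRules A B ρ γ * 2 ^ (m ∸ ∣ A ∣)
matchingSwaps-scaled []          []          ρ tt with ρ tt
... | true  = refl
... | false = refl
matchingSwaps-scaled {suc m} (true ∷ A)  (true ∷ B)  ρ (v , γ) =
  trans (matchingSwaps-scaled A B (λ δ → ρ (v , δ)) γ)
        (cong (_* 2 ^ (m ∸ ∣ A ∣)) (sym (consistentRules-true-true A B ρ v γ)))
matchingSwaps-scaled {suc m} (true ∷ A)  (false ∷ B) ρ γ = begin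
  (s₁ + s₀) * 2 ^ k         ≡⟨ *-distribʳ-+ (2 ^ k) s₁ s₀ ⟩
  s₁ * 2 ^ k + s₀ * 2 ^ k   ≡⟨ cong₂ _+_ (matchingSwaps-scaled A B _ γ) (matchingSwaps-scaled A B _ γ) ⟩
  c₁ * 2 ^ e + c₀ * 2 ^ e   ≡⟨ sym (*-distribʳ-+ (2 ^ e) c₁ c₀) ⟩
  (c₁ + c₀) * 2 ^ e         ≡⟨ cong (_* 2 ^ e) (sym (consistentRules-true-false A B ρ γ)) ⟩
  consistentRules (true ∷ A) (false ∷ B) ρ γ * 2 ^ e ∎
  where
  open ≡-Reasoning
  k = ∣ B ─ A ∣
  e = m ∸ ∣ A ∣
  s₁ = matchingSwaps A B (λ δ → ρ (true , δ)) γ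
  s₀ = matchingSwaps A B (λ δ → ρ (false , δ)) γ
  c₁ = consistentRules A B (λ δ → ρ (true , δ)) γ
  c₀ = consistentRules A B (λ δ → ρ (false , δ)) γ
matchingSwaps-scaled (false ∷ A) (true ∷ B)  ρ (v , γ) =
  trans (*-double (matchingSwaps A B ρ γ) (2 ^ ∣ B ─ A ∣))
        (double-*2^-∸ A (consistentRules A B ρ γ) (matchingSwaps-scaled A B ρ γ))
matchingSwaps-scaled (false ∷ A) (false ∷ B) ρ γ =
  trans (*-distribʳ-+ (2 ^ ∣ B ─ A ∣) (matchingSwaps A B ρ γ) (matchingSwaps A B ρ γ))
        (double-*2^-∸ A (consistentRules A B ρ γ) (matchingSwaps-scaled A B ρ γ))

disagreements : ∀ {m} → List (CPT m) → Bool → Swap m → ℕ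
disagreements T b x = lsum (lmap (λ Ns → indicator (b xor vote Ns x)) T)

disagreements-total : ∀ {m} (T : List (CPT m)) x →
  disagreements T false x + disagreements T true x ≡ length T
disagreements-total []       x = refl
disagreements-total (Ns ∷ T) x =
  trans (interchange (indicator (vote Ns x)) _ (indicator (not (vote Ns x))) _)
        (cong₂ _+_ (one-of (vote Ns x)) (disagreements-total T x))
  where
  one-of : ∀ v → indicator v + indicator (not v) ≡ 1
  one-of true  = refl
  one-of false = refl

f-as-sumSwaps : ∀ m (T : List (CPT m)) N → f T N ≡ sumSwaps m (λ x → disagreements T (vote N x) x)
f-as-sumSwaps m []       N = sym (sumSwaps-zero m)
  where
  sumSwaps-zero : ∀ m → sumSwaps m (λ _ → 0) ≡ 0
  sumSwaps-zero zero    = refl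
  sumSwaps-zero (suc m) = cong₂ _+_ (sumSwaps-zero m) (sumSwaps-zero m)
f-as-sumSwaps m (Ns ∷ T) N =
  trans (cong₂ _+_ (count-allSwaps m _) (f-as-sumSwaps m T N)) (sym (sumSwaps-+ m _ _))

f-cong : ∀ {m} (T : List (CPT m)) (N N′ : CPT m) → (∀ x → vote N x ≡ vote N′ x) → f T N ≡ f T N′
f-cong {m} T N N′ e = trans (f-as-sumSwaps m T N)
  (trans (sumSwaps-cong m (λ x → cong (λ v → disagreements T v x) (e x))) (sym (f-as-sumSwaps m T N′)))

zerovotes≡ : ∀ {m} (T : List (CPT m)) P γ → zerovotes T P γ ≡ sumExtending P γ (disagreements T true)
zerovotes≡ []       P γ = sym (sumExtending-const P γ 0)
zerovotes≡ {m} (Ns ∷ T) P γ =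
  trans (cong₂ _+_ summand (zerovotes≡ T P γ)) (sym (sumExtending-+ P γ _ _))
  where
  k = ∣ P ─ Pa Ns ∣
  s = matchingSwaps (Pa Ns) P (λ δ → not (rule Ns δ)) γ
  summand : (r P Ns γ * 2 ^ (m ∸ ∣ Pa Ns ∣)) /2^ k ≡ s
  summand = trans (cong (_/2^ k) (sym (matchingSwaps-scaled (Pa Ns) P _ γ)))
                  (m*n/n≡m s (2 ^ k) {{m^n≢0 2 k}})

onevotes≡ : ∀ {m} (T : List (CPT m)) P γ → onevotes T P γ ≡ sumExtending P γ (disagreements T false)
onevotes≡ {m} T P γ = begin
  length T * 2 ^ (m ∸ ∣ P ∣) ∸ zerovotes T P γ
    ≡⟨ cong₂ _∸_ (sym (sumExtending-const P γ (length T))) (zerovotes≡ T P γ) ⟩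
  sumExtending P γ (λ _ → length T) ∸ d₁
    ≡⟨ cong (_∸ d₁) (sumExtending-cong P γ (λ x → sym (disagreements-total T x))) ⟩
  sumExtending P γ (λ x → disagreements T false x + disagreements T true x) ∸ d₁
    ≡⟨ cong (_∸ d₁) (sumExtending-+ P γ _ _) ⟩
  d₀ + d₁ ∸ d₁
    ≡⟨ m+n∸n≡m d₀ d₁ ⟩
  d₀ ∎
  where
  open ≡-Reasoning
  d₀ = sumExtending P γ (disagreements T false)
  d₁ = sumExtending P γ (disagreements T true)

not-<ᵇ-minimises : ∀ (w : Bool → ℕ) b → w (not (w false <ᵇ w true)) ≤ w b
not-<ᵇ-minimises w b with w false <ᵇ w true in lt
not-<ᵇ-minimises w false | true  = ≤-refl
not-<ᵇ-minimises w true  | true  = <⇒≤ (<ᵇ⇒< (w false) (w true) (subst T (sym lt) tt))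
not-<ᵇ-minimises w true  | false = ≤-refl
not-<ᵇ-minimises w false | false = ≮⇒≥ (λ w₀<w₁ → subst T lt (<⇒<ᵇ w₀<w₁))

alg2-raw-rule-minimises : ∀ {m} (T : List (CPT m)) P γ b →
  sumExtending P γ (disagreements T (rule (alg2-raw T P) γ)) ≤ sumExtending P γ (disagreements T b)
alg2-raw-rule-minimises T P γ b =
  subst (λ v → cost v ≤ cost b) (sym rule≡) (not-<ᵇ-minimises cost b)
  where
  cost : Bool → ℕ
  cost v = sumExtending P γ (disagreements T v)
  rule≡ : rule (alg2-raw T P) γ ≡ not (cost false <ᵇ cost true)
  rule≡ = cong₂ (λ o z → not (o <ᵇ z)) (onevotes≡ T P γ) (zerovotes≡ T P γ)

alg2-raw-optimal : ∀ m (T : List (CPT m)) P (ρ : Inst P → Bool) → f T (alg2-raw T P) ≤ f T (mkCPT P ρ)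
alg2-raw-optimal m T P ρ =
  subst₂ _≤_ (sym (f-as-sumSwaps m T (alg2-raw T P))) (sym (f-as-sumSwaps m T (mkCPT P ρ)))
    (contextwise-optimal m P (disagreements T) (rule (alg2-raw T P)) ρ (alg2-raw-rule-minimises T P))

extendParents : ∀ {m} → Subset m → CPT m → CPT m
extendParents P N = mkCPT P (λ γ → vote N (embed P γ))

restrict-embed-restrict : ∀ {m} (A P : Subset m) → A ⊆ P → ∀ x →
  restrict A (embed P (restrict P x)) ≡ restrict A x
restrict-embed-restrict []          []          _ []      = refl
restrict-embed-restrict (true ∷ A)  (true ∷ P)  A⊆P (v ∷ x) = cong (v ,_) (restrict-embed-restrict A P (drop-∷-⊆ A⊆P) x)
restrict-embed-restrict (true ∷ A)  (false ∷ P) A⊆P (v ∷ x) with A⊆P here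
... | ()
restrict-embed-restrict (false ∷ A) (true ∷ P)  A⊆P (v ∷ x) = restrict-embed-restrict A P (drop-∷-⊆ A⊆P) x
restrict-embed-restrict (false ∷ A) (false ∷ P) A⊆P (v ∷ x) = restrict-embed-restrict A P (drop-∷-⊆ A⊆P) x

vote-extendParents : ∀ {m} P (N : CPT m) → Pa N ⊆ P → ∀ x → vote (extendParents P N) x ≡ vote N x
vote-extendParents P N Pa⊆P x = cong (rule N) (restrict-embed-restrict (Pa N) P Pa⊆P x)

lookup-embed-restrict : ∀ {m} (R : Subset m) x i → lookup R i ≡ true →
  lookup (embed R (restrict R x)) i ≡ lookup x i
lookup-embed-restrict (true ∷ R)  (v ∷ x) fzero    _ = refl
lookup-embed-restrict (true ∷ R)  (v ∷ x) (fsuc i) e = lookup-embed-restrict R x i e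
lookup-embed-restrict (false ∷ R) (v ∷ x) (fsuc i) e = lookup-embed-restrict R x i e

restrict-updateAt-outside : ∀ {m} (A : Subset m) i z → lookup A i ≡ false →
  restrict A z ≡ restrict A (updateAt z i not)
restrict-updateAt-outside (true ∷ A)  (fsuc i) (v ∷ z) e = cong (v ,_) (restrict-updateAt-outside A i z e)
restrict-updateAt-outside (false ∷ A) fzero    (v ∷ z) _ = refl
restrict-updateAt-outside (false ∷ A) (fsuc i) (v ∷ z) e = restrict-updateAt-outside A i z e

FlipInvariantOutside : ∀ {m} → (Swap m → Bool) → (Fin m → Bool) → Set
FlipInvariantOutside g S = ∀ i → S i ≡ false → ∀ z → g z ≡ g (updateAt z i not)

flipInvariant⇒agreeing≡ : ∀ {m} (g : Swap m → Bool) (S : Fin m → Bool) → FlipInvariantOutside g S →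
  ∀ x y → (∀ i → S i ≡ true → lookup x i ≡ lookup y i) → g x ≡ g y
flipInvariant⇒agreeing≡ g S inv []      []      _     = refl
flipInvariant⇒agreeing≡ g S inv (a ∷ x) (b ∷ y) agree =
  trans head (flipInvariant⇒agreeing≡ (λ z → g (b ∷ z)) (λ i → S (fsuc i))
                (λ i e z → inv (fsuc i) e (b ∷ z)) x y (λ i → agree (fsuc i)))
  where
  anyHead : (∀ z → g z ≡ g (updateAt z fzero not)) → ∀ a b → g (a ∷ x) ≡ g (b ∷ x)
  anyHead flip true  true  = refl
  anyHead flip false false = refl
  anyHead flip true  false = flip (true ∷ x)
  anyHead flip false true  = flip (false ∷ x)
  head : g (a ∷ x) ≡ g (b ∷ x)
  head with S fzero in e
  ... | true  = cong (λ c → g (c ∷ x)) (agree fzero e)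
  ... | false = anyHead (inv fzero e) a b

vote-flipInvariant : ∀ {m} (N : CPT m) → FlipInvariantOutside (vote N) (relevant N)
vote-flipInvariant {m} N i irrelevant z with lookup (Pa N) i in e
... | false = cong (rule N) (restrict-updateAt-outside (Pa N) i z e)
... | true  = xor≡false⇒≡ _ _ (any-allSwaps≡false m _ irrelevant z)

vote-removeIrrelevant : ∀ {m} (N : CPT m) x → vote (removeIrrelevant N) x ≡ vote N x
vote-removeIrrelevant N x =
  flipInvariant⇒agreeing≡ (vote N) (relevant N) (vote-flipInvariant N) _ x
    (λ i e → lookup-embed-restrict (tabulate (relevant N)) x i (trans (lookup∘tabulate (relevant N) i) e))

theorem13 : (m : ℕ) (T : List (CPT m)) (P : Subset m) (N : CPT m) →
            Pa N ⊆ P → f T (alg2 T P) ≤ f T N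
theorem13 m T P N Pa⊆P = begin
  f T (alg2 T P)              ≡⟨ f-cong T (alg2 T P) (alg2-raw T P) (vote-removeIrrelevant (alg2-raw T P)) ⟩
  f T (alg2-raw T P)          ≤⟨ alg2-raw-optimal m T P (rule (extendParents P N)) ⟩
  f T (extendParents P N)     ≡⟨ f-cong T (extendParents P N) N (vote-extendParents P N Pa⊆P) ⟩
  f T N                       ∎
  where open ≤-Reasoning
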